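{- For every integer $n\ge1$, the number of sequences $\epsilon\in\{0,1\}^{2n}$ with $C_n(\epsilon)\neq0$ is at most $\left\lfloor \frac{2^{2n}}{3}\right\rfloor+1$.
   Context: For $m\ge1$, $\mathbb{Z}\langle\{0,1\}^m\rangle$ is the free abelian group with basis the binary sequences of length $m$; maps on basis elements are extended $\mathbb{Z}$-linearly, and a function $\{0,1\}^m\to\mathbb{Z}_{\ge0}$ extends to a homomorphism to $\mathbb{Z}$ (sending $0$ to $0$). (i) $R_m(\epsilon_1,\ldots,\epsilon_m)=(1-\epsilon_1,\ldots,1-\epsilon_m)$. (ii) For $m\ge2$, $1\le i\le m-1$: $E_m^i(\epsilon)=\epsilon+\epsilon'$ if $(\epsilon_i,\epsilon_{i+1})=(0,0)$, with $\epsilon'$ equal to $\epsilon$ with entries $i,i+1$ replaced by $1,1$; $E_m^i(\epsilon)=\epsilon$ otherwise. $E_m=E_m^{m-1}\circ\cdots\circ E_m^1$. (iii) For $m\ge4$, $K_m:\mathbb{Z}\langle\{0,1\}^m\rangle\to\mathbb{Z}\langle\{0,1\}^{m-2}\rangle$: $K_m(\epsilon)=0$ if $(\epsilon_1,\epsilon_2)=(0,1)$ or $(\epsilon_{m-1},\epsilon_m)=(1,0)$; otherwise $K_m(\epsilon)=(a,\epsilon_3,\ldots,\epsilon_{m-2},b)$ with $a=0$ if $(\epsilon_1,\epsilon_2)=(1,0)$, $a=1$ if $(\epsilon_1,\epsilon_2)\in\{(0,0),(1,1)\}$, $b=0$ if $(\epsilon_{m-1},\epsilon_m)=(0,1)$,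 $b=1$ if $(\epsilon_{m-1},\epsilon_m)\in\{(0,0),(1,1)\}$. (iv) $C_1(0,0)=C_1(1,1)=1$, $C_1(0,1)=C_1(1,0)=0$; for $n\ge2$, $C_n:\{0,1\}^{2n}\to\mathbb{Z}_{\ge0}$ is $C_n=C_{n-1}\circ R_{2n-2}\circ E_{2n-2}\circ K_{2n}$. -}

module Defs where

open import Data.Nat using (ℕ; zero; suc; _+_)
open import Data.Bool using (Bool; true; false; not)
open import Data.Vec using (Vec; []; _∷_; map)
open import Data.List as L using (List; []; _∷_; [_]; concatMap; _++_; length; filter)
open import Data.Nat.ListAction using (sum)
open import Data.Product using (_×_; _,_)

-- Binary sequences of length m; false = 0, true = 1.
Seq : ℕ → Set
Seq m = Vec Bool m

-- An element of Z<{0,1}^m> with nonnegative coefficients, written as a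
-- formal sum (list) of basis elements, repetitions = multiplicities.
-- All maps below send basis elements to such sums, so this suffices.
Chain : ℕ → Set
Chain m = List (Seq m)

lin : ∀ {m k} → (Seq m → Chain k) → Chain m → Chain k
lin f = concatMap f

R : ∀ {m} → Seq m → Seq m
R = map not

-- (ii) E_m^{j+1}, with j = i - 1 the 0-based position.
Eat : ∀ {m} → ℕ → Seq m → Chain m
Eat zero (false ∷ false ∷ rest) = (false ∷ false ∷ rest) ∷ (true ∷ true ∷ rest) ∷ []
Eat zero v = [ v ]
Eat (suc j) [] = [ [] ]
Eat (suc j) (x ∷ v) = L.map (x ∷_) (Eat j v)

Eseq : ∀ {m} → ℕ → ℕ → Chain m → Chain m
Eseq j zero c = c
Eseq j (suc r) c = Eseq (suc j) r (lin (Eat j) c)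

-- E_m = E_m^{m-1} ∘ ... ∘ E_m^1  (for m ≥ 2; m - 1 factors)
E : ∀ {m} → Seq m → Chain m
E {zero} v = [ v ]
E {suc m} v = Eseq 0 m [ v ]

lastTwo : ∀ {k} → Vec Bool (suc (suc k)) → Vec Bool k × Bool × Bool
lastTwo {zero} (c ∷ d ∷ []) = [] , c , d
lastTwo {suc k} (x ∷ v) with lastTwo v
... | mid , c , d = (x ∷ mid) , c , d

snoc : ∀ {k} → Vec Bool k → Bool → Vec Bool (suc k)
snoc [] b = b ∷ []
snoc (x ∷ v) b = x ∷ snoc v b

K : ∀ {k} → Seq (suc (suc (suc (suc k)))) → Chain (suc (suc k))
K (false ∷ true ∷ rest) = []
K {k} (e1 ∷ e2 ∷ rest) with lastTwo rest
... | mid , true , false = []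
... | mid , c , d = [ a e1 e2 ∷ snoc mid (b c d) ]
  where
  a : Bool → Bool → Bool
  a true false = false
  a _ _ = true
  b : Bool → Bool → Bool
  b false true = false
  b _ _ = true

-- length 2n written as len (n - 1), so that K applies definitionally
double : ℕ → ℕ
double zero = zero
double (suc k) = suc (suc (double k))

len : ℕ → ℕ
len k = suc (suc (double k))

-- (iv) C_n with n = k + 1, on sequences of length 2n = len k
C : (k : ℕ) → Seq (len k) → ℕ
C zero (x ∷ y ∷ []) with x | y
... | false | false = 1
... | true | true = 1
... | _ | _ = 0
C (suc k) ε = sum (L.map (C k) (L.map R (lin E (K ε))))

allSeqs : (m : ℕ) → List (Seq m)
allSeqs zero = [ [] ]
allSeqs (suc m) = L.map (false ∷_) (allSeqs m) ++ L.map (true ∷_) (allSeqs m)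

-- Give ε the alternating sum ε₁ − ε₂ + ε₃ − ⋯ . Each E^i trades a pair 00 at positions
-- i, i+1 for 11, which does not change it; R negates it on sequences of even length, and a
-- case check shows that K negates it too. So by induction C_n(ε) = 0 unless the alternating
-- sum of ε vanishes, that is, unless ε agrees with 1010⋯10 in exactly n places. There are
-- binom(2n, n) such ε, and 3 binom(2n, n) ≤ 4^n + 2 by induction from
-- (n+1) binom(2n+2, n+1) = 2(2n+1) binom(2n, n) and 3n + 1 ≤ 4^n.

module Submission where

open import Defs
open import Data.Bool using (Bool; true; false; not)
open import Data.Nat as ℕ using (ℕ; zero; suc)
open import Data.Product using (_,_)
open import Data.Vec using (Vec; []; _∷_)
open import Function using (_∘_)
open import Relation.Binary.PropositionalEquality

agree : Bool → Bool → ℕ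
agree true  true  = 1
agree false false = 1
agree _     _     = 0

matches : ∀ {m} → Bool → Seq m → ℕ
matches b [] = 0
matches b (x ∷ v) = agree x b ℕ.+ matches (not b) v

module AlternatingSum where

  open import Data.Integer as ℤ using (ℤ; +_; -_; _+_; _-_; 0ℤ; 1ℤ)
  import Data.Integer.Properties as ℤ
  open import Data.Integer.Tactic.RingSolver using (solve-∀)
  open import Data.List using (List)
  open import Data.List.Relation.Unary.All as All using (All; []; _∷_)
  open import Data.List.Relation.Unary.All.Properties using (concat⁺; map⁺)
  open import Data.Nat.ListAction using (sum)
  open import Relation.Nullary using (contradiction)
  open import Relation.Nullary.Decidable using (decidable-stable)
  open ≡-Reasoning

  bit : Bool → ℤ
  bit false = 0ℤ
  bit true = 1ℤ

  bit-not : ∀ x → bit (not x) ≡ 1ℤ - bit x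
  bit-not false = refl
  bit-not true = refl

  altSum : ∀ {m} → Vec Bool m → ℤ
  altSum [] = 0ℤ
  altSum (x ∷ v) = bit x - altSum v

  altSum-R : ∀ j (v : Vec Bool (double j)) → altSum (R v) ≡ - altSum v
  altSum-R zero [] = refl
  altSum-R (suc j) (x ∷ y ∷ v) = begin
    bit (not x) - (bit (not y) - altSum (R v))
      ≡⟨ cong₂ _-_ (bit-not x) (cong₂ _-_ (bit-not y) (altSum-R j v)) ⟩
    (1ℤ - a) - ((1ℤ - b) - - s)
      ≡⟨ negate-pair a b s ⟩
    - (a - (b - s)) ∎
    where
    a = bit x
    b = bit y
    s = altSum v
    negate-pair : ∀ a b s → (1ℤ - a) - ((1ℤ - b) - - s) ≡ - (a - (b - s))
    negate-pair = solve-∀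

  All-lin : ∀ {m k} {P : Seq m → Set} {Q : Seq k → Set} {f : Seq m → Chain k} →
            (∀ {t} → P t → All Q (f t)) → ∀ {c} → All P c → All Q (lin f c)
  All-lin h ps = concat⁺ (map⁺ (All.map h ps))

  altSum-Eat : ∀ {m} j (v : Seq m) → All (λ s → altSum s ≡ altSum v) (Eat j v)
  altSum-Eat zero [] = refl ∷ []
  altSum-Eat zero (true ∷ v) = refl ∷ []
  altSum-Eat zero (false ∷ []) = refl ∷ []
  altSum-Eat zero (false ∷ true ∷ v) = refl ∷ []
  altSum-Eat zero (false ∷ false ∷ v) = refl ∷ ones≡zeros (altSum v) ∷ []
    where
    ones≡zeros : ∀ s → 1ℤ - (1ℤ - s) ≡ 0ℤ - (0ℤ - s)
    ones≡zeros = solve-∀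
  altSum-Eat (suc j) [] = refl ∷ []
  altSum-Eat (suc j) (x ∷ v) = map⁺ (All.map (cong (λ s → bit x - s)) (altSum-Eat j v))

  altSum-Eseq : ∀ {m} j r {z} {c : Chain m} →
                All (λ s → altSum s ≡ z) c → All (λ s → altSum s ≡ z) (Eseq j r c)
  altSum-Eseq j zero h = h
  altSum-Eseq j (suc r) h =
    altSum-Eseq (suc j) r (All-lin (λ {t} eq → All.map (λ e → trans e eq) (altSum-Eat j t)) h)

  altSum-E : ∀ {m} (v : Seq m) → All (λ s → altSum s ≡ altSum v) (E v)
  altSum-E {zero} v = refl ∷ []
  altSum-E {suc m} v = altSum-Eseq 0 m (refl ∷ [])

  alternate-+ : ∀ x y s t → x - (y - (s + t)) ≡ x - (y - s) + t
  alternate-+ = solve-∀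

  altSum-snoc : ∀ j (v : Vec Bool (double j)) b → altSum (snoc v b) ≡ altSum v + bit b
  altSum-snoc zero [] b = ℤ.+-comm (bit b) 0ℤ
  altSum-snoc (suc j) (x ∷ y ∷ v) b rewrite altSum-snoc j v b =
    alternate-+ (bit x) (bit y) (altSum v) (bit b)

  altSum-lastTwo : ∀ j (v : Vec Bool (suc (suc (double j)))) →
                   let (mid , c , d) = lastTwo v in altSum v ≡ altSum mid + (bit c - bit d)
  altSum-lastTwo zero (c ∷ d ∷ []) = lastPair (bit c) (bit d)
    where
    lastPair : ∀ c d → c - (d - 0ℤ) ≡ 0ℤ + (c - d)
    lastPair = solve-∀
  altSum-lastTwo (suc j) (x ∷ y ∷ v) with lastTwo v | altSum-lastTwo j v
  ... | mid , c , d | eq rewrite eq = alternate-+ (bit x) (bit y) (altSum mid) (bit c - bit d)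

  altSum-K-summand : ∀ {j} (rest : Vec Bool (suc (suc (double j)))) (mid : Vec Bool (double j))
                     e₁ e₂ c d x y →
                     altSum rest ≡ altSum mid + (bit c - bit d) →
                     bit x - bit y ≡ - (bit e₁ - bit e₂) - (bit c - bit d) →
                     altSum (x ∷ snoc mid y) ≡ - altSum (e₁ ∷ e₂ ∷ rest)
  altSum-K-summand {j} rest mid e₁ e₂ c d x y rest≡ xy≡
    rewrite altSum-snoc j mid y | rest≡ = begin
    bit x - (altSum mid + bit y)
      ≡⟨ regroup (bit x) (bit y) (altSum mid) ⟩
    (bit x - bit y) - altSum mid
      ≡⟨ cong (_- altSum mid) xy≡ ⟩
    (- (bit e₁ - bit e₂) - (bit c - bit d)) - altSum mid
      ≡⟨ collect (bit e₁) (bit e₂) (bit c - bit d) (altSum mid) ⟩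
    - (bit e₁ - (bit e₂ - (altSum mid + (bit c - bit d)))) ∎
    where
    regroup : ∀ x y m → x - (m + y) ≡ (x - y) - m
    regroup = solve-∀
    collect : ∀ e₁ e₂ t m → (- (e₁ - e₂) - t) - m ≡ - (e₁ - (e₂ - (m + t)))
    collect = solve-∀

  -- Each refl below is the check that K's first and last bits a, b satisfy
  -- a − b = (ε₂ − ε₁) − (ε_{m−1} − ε_m).
  altSum-K : ∀ j (ε : Seq (suc (suc (suc (suc (double j)))))) →
             All (λ t → altSum t ≡ - altSum ε) (K ε)
  altSum-K j (false ∷ true ∷ rest) = []
  altSum-K j (false ∷ false ∷ rest) with lastTwo rest | altSum-lastTwo j rest
  ... | _   , true  , false | _  = []
  ... | mid , false , false | eq = altSum-K-summand rest mid false false false false true true eq refl ∷ []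
  ... | mid , false , true  | eq = altSum-K-summand rest mid false false false true true false eq refl ∷ []
  ... | mid , true  , true  | eq = altSum-K-summand rest mid false false true true true true eq refl ∷ []
  altSum-K j (true ∷ false ∷ rest) with lastTwo rest | altSum-lastTwo j rest
  ... | _   , true  , false | _  = []
  ... | mid , false , false | eq = altSum-K-summand rest mid true false false false false true eq refl ∷ []
  ... | mid , false , true  | eq = altSum-K-summand rest mid true false false true false false eq refl ∷ []
  ... | mid , true  , true  | eq = altSum-K-summand rest mid true false true true false true eq refl ∷ []
  altSum-K j (true ∷ true ∷ rest) with lastTwo rest | altSum-lastTwo j rest
  ... | _   , true  , false | _  = []
  ... | mid , false , false | eq = altSum-K-summand rest mid true true false false true true eq refl ∷ []
  ... | mid , false , true  | eq = altSum-K-summand rest mid true true false true true false eq refl ∷ []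
  ... | mid , true  , true  | eq = altSum-K-summand rest mid true true true true true true eq refl ∷ []


  sum-zero : ∀ {ns : List ℕ} → All (_≡ 0) ns → sum ns ≡ 0
  sum-zero [] = refl
  sum-zero (refl ∷ ps) = sum-zero ps

  altSum≢0⇒C≡0 : ∀ k (ε : Seq (len k)) → altSum ε ≢ 0ℤ → C k ε ≡ 0
  altSum≢0⇒C≡0 zero (false ∷ false ∷ []) ne = contradiction refl ne
  altSum≢0⇒C≡0 zero (false ∷ true ∷ []) ne = refl
  altSum≢0⇒C≡0 zero (true ∷ false ∷ []) ne = refl
  altSum≢0⇒C≡0 zero (true ∷ true ∷ []) ne = contradiction refl ne
  altSum≢0⇒C≡0 (suc k) ε ne = sum-zero (map⁺ (map⁺ (All.map vanish summands)))
    where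
    summands : All (λ s → altSum s ≡ - altSum ε) (lin E (K ε))
    summands = All-lin (λ {t} eq → All.map (λ e → trans e eq) (altSum-E t)) (altSum-K k ε)
    vanish : ∀ {s} → altSum s ≡ - altSum ε → C k (R s) ≡ 0
    vanish {s} eq = altSum≢0⇒C≡0 k (R s) λ R0 → ne (begin
      altSum ε       ≡⟨ ℤ.neg-involutive (altSum ε) ⟨
      - - altSum ε   ≡⟨ cong -_ eq ⟨
      - altSum s     ≡⟨ altSum-R (suc k) s ⟨
      altSum (R s)   ≡⟨ R0 ⟩
      0ℤ             ∎)

  bit≡agree-true : ∀ x → bit x ≡ + agree x true
  bit≡agree-true false = refl
  bit≡agree-true true = refl

  1-bit≡agree-false : ∀ x → 1ℤ - bit x ≡ + agree x false
  1-bit≡agree-false false = refl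
  1-bit≡agree-false true = refl

  altSum+n≡matches : ∀ n (v : Vec Bool (double n)) → altSum v + + n ≡ + matches true v
  altSum+n≡matches zero [] = refl
  altSum+n≡matches (suc n) (x ∷ y ∷ v) = begin
    bit x - (bit y - altSum v) + (1ℤ + + n)
      ≡⟨ regroup (bit x) (bit y) (altSum v) (+ n) ⟩
    bit x + ((1ℤ - bit y) + (altSum v + + n))
      ≡⟨ cong₂ _+_ (bit≡agree-true x) (cong₂ _+_ (1-bit≡agree-false y) (altSum+n≡matches n v)) ⟩
    + matches true (x ∷ y ∷ v) ∎
    where
    regroup : ∀ x y s n → x - (y - s) + (1ℤ + n) ≡ x + ((1ℤ - y) + (s + n))
    regroup = solve-∀

  C≢0⇒matches≡n : ∀ k (ε : Seq (len k)) → C k ε ≢ 0 → matches true ε ≡ suc k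
  C≢0⇒matches≡n k ε C≢0 =
    ℤ.+-injective (trans (sym (altSum+n≡matches (suc k) ε)) (cong (_+ + suc k) altSum≡0))
    where
    altSum≡0 : altSum ε ≡ 0ℤ
    altSum≡0 = decidable-stable (altSum ε ℤ.≟ 0ℤ) (C≢0 ∘ altSum≢0⇒C≡0 k ε)

open AlternatingSum using (C≢0⇒matches≡n)

open import Data.List using ([]; _∷_; _++_; map; filter; length)
open import Data.List.Properties using (filter-++; length-++; filter-none; filter-≐)
open import Data.List.Relation.Binary.Sublist.Propositional using (⊆-refl)
open import Data.List.Relation.Binary.Sublist.Propositional.Properties using (filter⁺; length-mono-≤)
open import Data.List.Relation.Unary.All using (universal)
open import Data.Nat
open import Data.Nat.Combinatorics using (nCk+nC[k+1]≡[n+1]C[k+1]; nCk≡nC[n∸k]; nC1≡n)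
  renaming (_C_ to _choose_)
open import Data.Nat.DivMod using (m*n/n≡m; /-monoˡ-≤; +-distrib-/-∣ʳ; n/n≡1)
open import Data.Nat.Divisibility using (∣-refl)
open import Data.Nat.Properties
open import Data.Nat.Tactic.RingSolver using (solve-∀)
open import Relation.Nullary using (¬?; does)
open import Relation.Unary using (Pred; Decidable)

length-filter-map : ∀ {a b p} {A : Set a} {B : Set b} {P : Pred B p} (P? : Decidable P) (f : A → B) xs →
                    length (filter P? (map f xs)) ≡ length (filter (P? ∘ f) xs)
length-filter-map P? f [] = refl
length-filter-map P? f (x ∷ xs) with does (P? (f x))
... | true  = cong suc (length-filter-map P? f xs)
... | false = length-filter-map P? f xs

preimageSize : ∀ m → (Seq m → ℕ) → ℕ → ℕ
preimageSize m f r = length (filter (λ v → f v ≟ r) (allSeqs m))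

preimageSize-suc : ∀ m (f : Seq (suc m) → ℕ) r →
                   preimageSize (suc m) f r
                     ≡ preimageSize m (f ∘ (false ∷_)) r + preimageSize m (f ∘ (true ∷_)) r
preimageSize-suc m f r = begin
  length (filter P? (map (false ∷_) vs ++ map (true ∷_) vs))
    ≡⟨ cong length (filter-++ P? (map (false ∷_) vs) _) ⟩
  length (filter P? (map (false ∷_) vs) ++ filter P? (map (true ∷_) vs))
    ≡⟨ length-++ (filter P? (map (false ∷_) vs)) ⟩
  length (filter P? (map (false ∷_) vs)) + length (filter P? (map (true ∷_) vs))
    ≡⟨ cong₂ _+_ (length-filter-map P? (false ∷_) vs) (length-filter-map P? (true ∷_) vs) ⟩
  preimageSize m (f ∘ (false ∷_)) r + preimageSize m (f ∘ (true ∷_)) r ∎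
  where
  open ≡-Reasoning
  P? = λ v → f v ≟ r
  vs = allSeqs m

preimageSize-suc∘-zero : ∀ m (f : Seq m → ℕ) → preimageSize m (suc ∘ f) 0 ≡ 0
preimageSize-suc∘-zero m f =
  cong length (filter-none (λ v → suc (f v) ≟ 0) (universal (λ v ()) (allSeqs m)))

preimageSize-suc∘-suc : ∀ m (f : Seq m → ℕ) r →
                        preimageSize m (suc ∘ f) (suc r) ≡ preimageSize m f r
preimageSize-suc∘-suc m f r =
  cong length (filter-≐ (λ v → suc (f v) ≟ suc r) (λ v → f v ≟ r) (suc-injective , cong suc) (allSeqs m))

preimageSize-pascal : ∀ m (f : Seq m → ℕ) → (∀ r → preimageSize m f r ≡ m choose r) →
                      ∀ r → preimageSize m f r + preimageSize m (suc ∘ f) r ≡ suc m choose r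
preimageSize-pascal m f f≡C zero
  rewrite f≡C zero | preimageSize-suc∘-zero m f = refl
preimageSize-pascal m f f≡C (suc r)
  rewrite f≡C (suc r) | preimageSize-suc∘-suc m f r | f≡C r =
  trans (+-comm (m choose suc r) (m choose r)) (nCk+nC[k+1]≡[n+1]C[k+1] m r)

preimageSize-matches : ∀ b m r → preimageSize m (matches b) r ≡ m choose r
preimageSize-matches b zero zero = refl
preimageSize-matches b zero (suc r) = refl
preimageSize-matches true (suc m) r = begin
  preimageSize (suc m) (matches true) r
    ≡⟨ preimageSize-suc m (matches true) r ⟩
  preimageSize m (matches false) r + preimageSize m (suc ∘ matches false) r
    ≡⟨ preimageSize-pascal m (matches false) (preimageSize-matches false m) r ⟩
  suc m choose r ∎
  where open ≡-Reasoning
preimageSize-matches false (suc m) r = begin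
  preimageSize (suc m) (matches false) r
    ≡⟨ preimageSize-suc m (matches false) r ⟩
  preimageSize m (suc ∘ matches true) r + preimageSize m (matches true) r
    ≡⟨ +-comm (preimageSize m (suc ∘ matches true) r) _ ⟩
  preimageSize m (matches true) r + preimageSize m (suc ∘ matches true) r
    ≡⟨ preimageSize-pascal m (matches true) (preimageSize-matches true m) r ⟩
  suc m choose r ∎
  where open ≡-Reasoning

double≡n+n : ∀ n → double n ≡ n + n
double≡n+n zero = refl
double≡n+n (suc n) = cong suc (trans (cong suc (double≡n+n n)) (sym (+-suc n n)))

[k+1]*[n+1]C[k+1]≡[n+1]*nCk : ∀ n k → suc k * (suc n choose suc k) ≡ suc n * (n choose k)
[k+1]*[n+1]C[k+1]≡[n+1]*nCk zero zero = refl
[k+1]*[n+1]C[k+1]≡[n+1]*nCk zero (suc k) = *-zeroʳ (suc (suc k))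
[k+1]*[n+1]C[k+1]≡[n+1]*nCk (suc n) zero =
  trans (+-identityʳ _) (trans (nC1≡n (suc (suc n))) (sym (*-identityʳ (suc (suc n)))))
[k+1]*[n+1]C[k+1]≡[n+1]*nCk (suc n) (suc k) = begin
  suc (suc k) * (suc (suc n) choose suc (suc k))
    ≡⟨ cong (suc (suc k) *_) (nCk+nC[k+1]≡[n+1]C[k+1] (suc n) (suc k)) ⟨
  suc (suc k) * (suc n choose suc k + suc n choose suc (suc k))
    ≡⟨ split k (suc n choose suc k) (suc n choose suc (suc k)) ⟩
  suc k * (suc n choose suc k) + suc n choose suc k + suc (suc k) * (suc n choose suc (suc k))
    ≡⟨ cong₂ _+_ (cong₂ _+_ ([k+1]*[n+1]C[k+1]≡[n+1]*nCk n k) (sym (nCk+nC[k+1]≡[n+1]C[k+1] n k)))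
                 ([k+1]*[n+1]C[k+1]≡[n+1]*nCk n (suc k)) ⟩
  suc n * (n choose k) + (n choose k + n choose suc k) + suc n * (n choose suc k)
    ≡⟨ merge n (n choose k) (n choose suc k) ⟩
  suc (suc n) * (n choose k + n choose suc k)
    ≡⟨ cong (suc (suc n) *_) (nCk+nC[k+1]≡[n+1]C[k+1] n k) ⟩
  suc (suc n) * (suc n choose suc k) ∎
  where
  open ≡-Reasoning
  split : ∀ k a b → suc (suc k) * (a + b) ≡ suc k * a + a + suc (suc k) * b
  split = solve-∀
  merge : ∀ n a b → suc n * a + (a + b) + suc n * b ≡ suc (suc n) * (a + b)
  merge = solve-∀

centralBinomial : ℕ → ℕ
centralBinomial n = double n choose n

[n+1]*centralBinomial[n+1] : ∀ n →
  suc n * centralBinomial (suc n) ≡ 2 * (suc (double n) * centralBinomial n)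
[n+1]*centralBinomial[n+1] n = begin
  suc n * (suc m choose suc n)
    ≡⟨ cong (suc n *_) (nCk+nC[k+1]≡[n+1]C[k+1] m n) ⟨
  suc n * (m choose n + m choose suc n)
    ≡⟨ cong (λ x → suc n * (x + m choose suc n)) middle-symmetric ⟩
  suc n * (m choose suc n + m choose suc n)
    ≡⟨ twice (suc n) (m choose suc n) ⟩
  2 * (suc n * (m choose suc n))
    ≡⟨ cong (2 *_) ([k+1]*[n+1]C[k+1]≡[n+1]*nCk (double n) n) ⟩
  2 * (suc (double n) * (double n choose n)) ∎
  where
  open ≡-Reasoning
  m = suc (double n)
  m≡n+[n+1] : m ≡ n + suc n
  m≡n+[n+1] = trans (cong suc (double≡n+n n)) (sym (+-suc n n))
  middle-symmetric : m choose n ≡ m choose suc n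
  middle-symmetric = subst (λ m → m choose n ≡ m choose suc n) (sym m≡n+[n+1])
    (trans (nCk≡nC[n∸k] (m≤m+n n (suc n))) (cong ((n + suc n) choose_) (m+n∸m≡n n (suc n))))
  twice : ∀ a b → a * (b + b) ≡ 2 * (a * b)
  twice = solve-∀

3n+1≤4^n : ∀ n → 3 * n + 1 ≤ 4 ^ n
3n+1≤4^n zero = ≤-refl
3n+1≤4^n (suc n) = begin
  3 * suc n + 1          ≤⟨ m≤m+n (3 * suc n + 1) (9 * n) ⟩
  3 * suc n + 1 + 9 * n  ≡⟨ regroup n ⟩
  4 * (3 * n + 1)        ≤⟨ *-monoʳ-≤ 4 (3n+1≤4^n n) ⟩
  4 ^ suc n              ∎
  where
  open ≤-Reasoning
  regroup : ∀ n → 3 * suc n + 1 + 9 * n ≡ 4 * (3 * n + 1)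
  regroup = solve-∀

3*centralBinomial≤4^n+2 : ∀ n → 3 * centralBinomial n ≤ 4 ^ n + 2
3*centralBinomial≤4^n+2 zero = ≤-refl
3*centralBinomial≤4^n+2 (suc n) = *-cancelˡ-≤ (suc n) (begin
  suc n * (3 * centralBinomial (suc n))  ≡⟨ *-assoc-comm (suc n) 3 (centralBinomial (suc n)) ⟩
  3 * (suc n * centralBinomial (suc n))  ≡⟨ cong (3 *_) ([n+1]*centralBinomial[n+1] n) ⟩
  3 * (2 * (suc d * c))                  ≡⟨ regroup d c ⟩
  (2 * suc d) * (3 * c)                  ≤⟨ *-monoʳ-≤ (2 * suc d) (3*centralBinomial≤4^n+2 n) ⟩
  (2 * suc d) * (P + 2)                  ≡⟨ cong (λ x → (2 * suc x) * (P + 2)) (double≡n+n n) ⟩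
  (2 * suc (n + n)) * (P + 2)            ≡⟨ expand n P ⟩
  (4 * n + 2) * P + 2 * (3 * n + 1) + (2 * n + 2)
    ≤⟨ +-monoˡ-≤ (2 * n + 2) (+-monoʳ-≤ ((4 * n + 2) * P) (*-monoʳ-≤ 2 (3n+1≤4^n n))) ⟩
  (4 * n + 2) * P + 2 * P + (2 * n + 2)  ≡⟨ collect n P ⟩
  suc n * (4 * P + 2)                    ∎)
  where
  open ≤-Reasoning
  c = centralBinomial n
  d = double n
  P = 4 ^ n
  *-assoc-comm : ∀ a b x → a * (b * x) ≡ b * (a * x)
  *-assoc-comm = solve-∀
  regroup : ∀ d c → 3 * (2 * (suc d * c)) ≡ (2 * suc d) * (3 * c)
  regroup = solve-∀
  expand : ∀ n P → (2 * suc (n + n)) * (P + 2) ≡ (4 * n + 2) * P + 2 * (3 * n + 1) + (2 * n + 2)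
  expand = solve-∀
  collect : ∀ n P → (4 * n + 2) * P + 2 * P + (2 * n + 2) ≡ suc n * (4 * P + 2)
  collect = solve-∀

m*c≤n+m⇒c≤n/m+1 : ∀ {m} .{{_ : NonZero m}} {c} n → m * c ≤ n + m → c ≤ n / m + 1
m*c≤n+m⇒c≤n/m+1 {m} {c} n mc≤n+m = begin
  c                ≡⟨ m*n/n≡m c m ⟨
  c * m / m        ≤⟨ /-monoˡ-≤ m (≤-trans (≤-reflexive (*-comm c m)) mc≤n+m) ⟩
  (n + m) / m      ≡⟨ +-distrib-/-∣ʳ n ∣-refl ⟩
  n / m + m / m    ≡⟨ cong (n / m +_) (n/n≡1 m) ⟩
  n / m + 1        ∎
  where open ≤-Reasoning

lemma1 : (k : ℕ) →
    length (filter (λ ε → ¬? (C k ε ≟ 0)) (allSeqs (len k)))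
      ≤ (2 ^ (2 * suc k)) / 3 + 1
lemma1 k = begin
  length (filter (λ ε → ¬? (C k ε ≟ 0)) (allSeqs (len k)))
    ≤⟨ length-mono-≤ (filter⁺ (λ ε → ¬? (C k ε ≟ 0)) (λ ε → matches true ε ≟ suc k)
                        (λ { refl → C≢0⇒matches≡n k _ }) (⊆-refl {x = allSeqs (len k)})) ⟩
  preimageSize (len k) (matches true) (suc k)
    ≡⟨ preimageSize-matches true (len k) (suc k) ⟩
  centralBinomial (suc k)
    ≤⟨ m*c≤n+m⇒c≤n/m+1 (2 ^ (2 * suc k)) bound ⟩
  2 ^ (2 * suc k) / 3 + 1 ∎
  where
  open ≤-Reasoning
  bound : 3 * centralBinomial (suc k) ≤ 2 ^ (2 * suc k) + 3
  bound = begin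
    3 * centralBinomial (suc k) ≤⟨ 3*centralBinomial≤4^n+2 (suc k) ⟩
    4 ^ suc k + 2               ≤⟨ +-monoʳ-≤ (4 ^ suc k) (n≤1+n 2) ⟩
    4 ^ suc k + 3               ≡⟨ cong (_+ 3) (^-*-assoc 2 2 (suc k)) ⟩
    2 ^ (2 * suc k) + 3         ∎
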